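{- Let $X \subseteq \mathbb{Z}_6^2$ with $|X| = 13$. Then there exists a subset $S \subseteq X$ with $|S| = 6$ and $\sum_{s \in S} s = (0,0)$.
   Context: $\mathbb{Z}_6^2 = \mathbb{Z}_6 \times \mathbb{Z}_6$ with componentwise addition modulo 6. -}

module Defs where

open import Data.Nat using (ℕ; _%_)
import Data.Nat as ℕ
open import Data.Fin using (Fin; toℕ; fromℕ<)
open import Data.Nat.DivMod using (m%n<n)
open import Data.Product using (_×_; _,_)
open import Data.List using (List; foldr)

ℤ₆ : Set
ℤ₆ = Fin 6

_+₆_ : ℤ₆ → ℤ₆ → ℤ₆
a +₆ b = fromℕ< (m%n<n (toℕ a ℕ.+ toℕ b) 6)

ℤ₆² : Set
ℤ₆² = ℤ₆ × ℤ₆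

0² : ℤ₆²
0² = (Fin.zero , Fin.zero)
  where import Data.Fin as Fin

_+²_ : ℤ₆² → ℤ₆² → ℤ₆²
(a , b) +² (c , d) = (a +₆ c , b +₆ d)

sum² : List ℤ₆² → ℤ₆²
sum² = foldr _+²_ 0²

-- The four cosets of 2ℤ₆² = {0,2,4}² partition ℤ₆², so a 13-set X meets one of them in at least
-- four points. Since 6h = 0, translating by −h (h one of these points) maps zero-sum 6-subsets to
-- zero-sum 6-subsets, so we may assume 0 ∈ X and |X ∩ 2ℤ₆²| ≥ 4. All such X are covered by one
-- exhaustive search, proved sound in general and run by the type checker: it chooses the other
-- twelve elements one at a time, keeps for k ≤ 5 a table of all sums of k chosen elements,
-- discards every candidate y with −y among the 5-sums (y would complete a zero-sum 6-subset), and
-- abandons every branch that can no longer reach 13 elements of which 4 lie in 2ℤ₆².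
module Submission where

open import Defs
open import Data.List using (List; length)
open import Data.List.Relation.Unary.Unique.Propositional using (Unique)
open import Data.List.Relation.Binary.Sublist.Propositional using (_⊆_)
open import Data.Product using (Σ; _×_)
open import Relation.Binary.PropositionalEquality using (_≡_)

open import Level using (0ℓ)
open import Algebra.Bundles using (AbelianGroup)
open import Algebra.Structures using (IsAbelianGroup)
open import Data.Bool using (Bool; true; false; T; not; _∧_; _∨_; if_then_else_)
open import Data.Bool.Properties using (T-∨; T-∧) renaming (_≟_ to _≟ᵇ_)
open import Data.Fin using (zero; suc; #_)
open import Data.Fin.Properties using (all?) renaming (_≟_ to _≟₆_)
open import Data.List using ([]; _∷_; [_]; _++_; map; filter; cartesianProduct; allFin)
open import Data.List.Properties using (length-++; length-map; filter-++; filter-all; filter-accept; ++-assoc; map-∘; map-id-local)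
open import Data.List.Membership.Propositional using (_∈_; find)
open import Data.List.Membership.Propositional.Properties using (∈-filter⁺; ∈-filter⁻; ∈-map⁺)
open import Data.List.Membership.Propositional.Properties.WithK using (unique∧set⇒bag)
open import Data.List.Relation.Binary.BagAndSetEquality using (∼bag⇒↭)
open import Data.List.Relation.Binary.Permutation.Propositional using (_↭_; ↭⇒↭ₛ)
open import Data.List.Relation.Binary.Permutation.Propositional.Properties using (↭-length; filter-↭)
open import Data.List.Relation.Binary.Permutation.Setoid.Properties using (foldr-commMonoid)
open import Data.List.Relation.Binary.Sublist.Propositional using ([]; _∷_; _∷ʳ_; ⊆-refl; ⊆-trans; from∈)
open import Data.List.Relation.Binary.Sublist.Propositional.Properties
  using ([]⊆-universal; ++⁺; ++⁺ʳ; map⁺; filter-⊆; filter⁺; length-mono-≤; All-resp-⊆; Any-resp-⊆)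
open import Data.List.Relation.Unary.All using (All; []; _∷_)
open import Data.List.Relation.Unary.All.Properties using (¬Any⇒All¬; all-filter)
import Data.List.Relation.Unary.All as All
import Data.List.Relation.Unary.All.Properties as All
open import Data.List.Relation.Unary.AllPairs using ([]; _∷_)
open import Data.List.Relation.Unary.Any using (here; there; any?)
import Data.List.Relation.Unary.Unique.Propositional.Properties as Unique
open import Data.Nat using (ℕ; zero; suc; _+_; _*_; _≤_; _≤ᵇ_; _≤?_; z≤n; s≤s)
open import Data.Nat.Properties using (+-comm; +-suc; +-mono-≤; +-monoʳ-≤; ≤-trans; ≤-reflexive; ≤⇒≤ᵇ; ≰⇒>; ≤-pred; n≮n; module ≤-Reasoning)
open import Data.Product using (∃; _,_; proj₁; proj₂)
open import Data.Product.Properties using (≡-dec)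
open import Data.Sum using (_⊎_; inj₁; inj₂; [_,_]′)
open import Data.Unit using (⊤; tt)
open import Data.Vec using (Vec; []; _∷_; lookup; tabulate; replicate; zipWith) renaming (map to mapᵛ)
open import Data.Vec.Properties using (lookup∘tabulate; lookup-zipWith; lookup-map)
open import Function using (_∘_; id)
open import Function.Bundles using (mk⇔; Equivalence)
open import Relation.Binary using (DecidableEquality)
open import Relation.Binary.PropositionalEquality using (refl; sym; trans; cong; cong₂; subst; subst₂; setoid; isEquivalence; module ≡-Reasoning)
open import Relation.Nullary using (yes; no; contradiction)
open import Relation.Nullary.Decidable using (isYes; from-yes; T?; _×-dec_; _→-dec_; ¬?; toWitness)
open import Relation.Unary using (Pred; Decidable)
open import Relation.Unary.Properties using (∁?)

count : {A : Set} {P : Pred A 0ℓ} → Decidable P → List A → ℕ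
count P? = length ∘ filter P?

module _ {A : Set} where

  count-++ : {P : Pred A 0ℓ} (P? : Decidable P) (xs ys : List A) →
             count P? (xs ++ ys) ≡ count P? xs + count P? ys
  count-++ P? xs ys = trans (cong length (filter-++ P? xs ys)) (length-++ (filter P? xs))

  count-mono : {P Q : Pred A 0ℓ} (P? : Decidable P) (Q? : Decidable Q) →
               (∀ {x} → P x → Q x) → ∀ xs → count P? xs ≤ count Q? xs
  count-mono P? Q? P⇒Q xs = length-mono-≤ (filter⁺ P? Q? (λ { refl → P⇒Q }) (⊆-refl {x = xs}))

  length≡count+count∁ : {P : Pred A 0ℓ} (P? : Decidable P) (xs : List A) →
            length xs ≡ count P? xs + count (∁? P?) xs
  length≡count+count∁ P? [] = refl
  length≡count+count∁ P? (x ∷ xs) with P? x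
  ... | yes _ = cong suc (length≡count+count∁ P? xs)
  ... | no _  = trans (cong suc (length≡count+count∁ P? xs)) (sym (+-suc _ _))

  count-map : {B : Set} {P : Pred B 0ℓ} (P? : Decidable P) (f : A → B) (xs : List A) →
              count P? (map f xs) ≡ count (P? ∘ f) xs
  count-map P? f [] = refl
  count-map P? f (x ∷ xs) with P? (f x)
  ... | yes _ = cong suc (count-map P? f xs)
  ... | no _  = count-map P? f xs

  additive-moveˡ : (μ : List A → ℕ) → (∀ xs ys → μ (xs ++ ys) ≡ μ xs + μ ys) →
                   ∀ C u Y → μ (C ++ [ u ]) + μ Y ≡ μ C + μ (u ∷ Y)
  additive-moveˡ μ μ-++ C u Y = begin
    μ (C ++ [ u ]) + μ Y  ≡⟨ sym (μ-++ (C ++ [ u ]) Y) ⟩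
    μ ((C ++ [ u ]) ++ Y) ≡⟨ cong μ (++-assoc C [ u ] Y) ⟩
    μ (C ++ u ∷ Y)        ≡⟨ μ-++ C (u ∷ Y) ⟩
    μ C + μ (u ∷ Y)       ∎
    where open ≡-Reasoning

  count-filter-≤ : {P Q : Pred A 0ℓ} (P? : Decidable P) (Q? : Decidable Q) (xs : List A) →
                   count P? (filter Q? xs) ≤ count P? xs
  count-filter-≤ P? Q? xs = length-mono-≤ (filter⁺ P? P? (λ { refl → id }) (filter-⊆ Q? xs))

  member-of-nonempty : {xs : List A} → 1 ≤ length xs → ∃ (_∈ xs)
  member-of-nonempty {x ∷ _} _ = x , here refl

  Unique-resp-⊇ : {xs ys : List A} → xs ⊆ ys → Unique ys → Unique xs
  Unique-resp-⊇ []         []       = []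
  Unique-resp-⊇ (y ∷ʳ τ)   (_ ∷ u)  = Unique-resp-⊇ τ u
  Unique-resp-⊇ (refl ∷ τ) (x∉ ∷ u) = All-resp-⊆ τ x∉ ∷ Unique-resp-⊇ τ u

  ↭-from-members : {xs ys : List A} → Unique xs → Unique ys →
                   (∀ {x} → x ∈ xs → x ∈ ys) → (∀ {x} → x ∈ ys → x ∈ xs) → xs ↭ ys
  ↭-from-members uxs uys xs⊆ys ys⊆xs = ∼bag⇒↭ (unique∧set⇒bag uxs uys (mk⇔ xs⊆ys ys⊆xs))

module _ {A B : Set} (_≟_ : DecidableEquality B) (f : A → B) where

  fibre? : (b : B) → Decidable (λ x → f x ≡ b)
  fibre? b x = f x ≟ b

  pigeonhole : ∀ {m} bs xs → All (λ x → f x ∈ bs) xs →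
               All (λ b → count (fibre? b) xs ≤ m) bs → length xs ≤ length bs * m
  pigeonhole     []       []      _        _              = z≤n
  pigeonhole     []       (_ ∷ _) (() ∷ _) _
  pigeonhole {m} (b ∷ bs) xs      cover    (small ∷ smalls) = begin
    length xs                         ≡⟨ length≡count+count∁ (fibre? b) xs ⟩
    count (fibre? b) xs + length rest ≤⟨ +-mono-≤ small (pigeonhole bs rest cover′ smalls′) ⟩
    m + length bs * m                 ∎
    where
      open ≤-Reasoning
      rest : List A
      rest = filter (∁? (fibre? b)) xs
      cover′ : All (λ x → f x ∈ bs) rest
      cover′ = All.zipWith (λ { (fx≢b , here fx≡b) → contradiction fx≡b fx≢b ; (_ , there fx∈bs) → fx∈bs })
                           (all-filter (∁? (fibre? b)) xs , All.filter⁺ (∁? (fibre? b)) cover)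
      smalls′ : All (λ c → count (fibre? c) rest ≤ m) bs
      smalls′ = All.map (λ {c} → ≤-trans (count-filter-≤ (fibre? c) (∁? (fibre? b)) xs)) smalls

-- The group ℤ₆²

neg₆ : ℤ₆ → ℤ₆
neg₆ zero                                = zero
neg₆ (suc zero)                          = # 5
neg₆ (suc (suc zero))                    = # 4
neg₆ (suc (suc (suc zero)))              = # 3
neg₆ (suc (suc (suc (suc zero))))        = # 2
neg₆ (suc (suc (suc (suc (suc zero)))))  = # 1

even₆ : ℤ₆ → Bool
even₆ zero                                = true
even₆ (suc zero)                          = false
even₆ (suc (suc zero))                    = true
even₆ (suc (suc (suc zero)))              = false
even₆ (suc (suc (suc (suc zero))))        = true
even₆ (suc (suc (suc (suc (suc zero)))))  = false

+₆-assoc : ∀ a b c → (a +₆ b) +₆ c ≡ a +₆ (b +₆ c)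
+₆-assoc = from-yes (all? λ a → all? λ b → all? λ c → (a +₆ b) +₆ c ≟₆ a +₆ (b +₆ c))

+₆-comm : ∀ a b → a +₆ b ≡ b +₆ a
+₆-comm = from-yes (all? λ a → all? λ b → a +₆ b ≟₆ b +₆ a)

+₆-identityˡ : ∀ a → zero +₆ a ≡ a
+₆-identityˡ = from-yes (all? λ a → zero +₆ a ≟₆ a)

+₆-inverseˡ : ∀ a → neg₆ a +₆ a ≡ zero
+₆-inverseˡ = from-yes (all? λ a → neg₆ a +₆ a ≟₆ zero)

even₆-sub : ∀ a b → even₆ a ≡ even₆ b → T (even₆ (a +₆ neg₆ b))
even₆-sub = from-yes (all? λ a → all? λ b → (even₆ a ≟ᵇ even₆ b) →-dec T? (even₆ (a +₆ neg₆ b)))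

neg² : ℤ₆² → ℤ₆²
neg² (a , b) = neg₆ a , neg₆ b

_-²_ : ℤ₆² → ℤ₆² → ℤ₆²
x -² y = x +² neg² y

infix 4 _≟²_
_≟²_ : DecidableEquality ℤ₆²
_≟²_ = ≡-dec _≟₆_ _≟₆_

open import Data.List.Membership.DecPropositional _≟²_ using (_∈?_)
open import Data.List.Relation.Unary.Unique.DecPropositional _≟²_ using (unique?)

+²-assoc : ∀ x y z → (x +² y) +² z ≡ x +² (y +² z)
+²-assoc (a , b) (c , d) (e , f) = cong₂ _,_ (+₆-assoc a c e) (+₆-assoc b d f)

+²-comm : ∀ x y → x +² y ≡ y +² x
+²-comm (a , b) (c , d) = cong₂ _,_ (+₆-comm a c) (+₆-comm b d)

+²-identityˡ : ∀ x → 0² +² x ≡ x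
+²-identityˡ (a , b) = cong₂ _,_ (+₆-identityˡ a) (+₆-identityˡ b)

+²-inverseˡ : ∀ x → neg² x +² x ≡ 0²
+²-inverseˡ (a , b) = cong₂ _,_ (+₆-inverseˡ a) (+₆-inverseˡ b)

ℤ₆²-isAbelianGroup : IsAbelianGroup _≡_ _+²_ 0² neg²
ℤ₆²-isAbelianGroup = record
  { isGroup = record
    { isMonoid = record
      { isSemigroup = record
        { isMagma = record { isEquivalence = isEquivalence ; ∙-cong = cong₂ _+²_ }
        ; assoc   = +²-assoc
        }
      ; identity = +²-identityˡ , λ x → trans (+²-comm x 0²) (+²-identityˡ x)
      }
    ; inverse = +²-inverseˡ , λ x → trans (+²-comm x (neg² x)) (+²-inverseˡ x)
    ; ⁻¹-cong = cong neg²
    }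
  ; comm = +²-comm
  }

ℤ₆²-abelianGroup : AbelianGroup 0ℓ 0ℓ
ℤ₆²-abelianGroup = record { isAbelianGroup = ℤ₆²-isAbelianGroup }

open AbelianGroup ℤ₆²-abelianGroup
  using (identityˡ; identityʳ; inverseˡ; inverseʳ; isCommutativeMonoid; commutativeSemigroup; group; rawMonoid)
open import Algebra.Properties.CommutativeSemigroup commutativeSemigroup using (interchange)
open import Algebra.Properties.Group group using (//-rightDividesˡ)
open import Algebra.Definitions.RawMonoid rawMonoid using () renaming (_×_ to _·_)

ℤ₆²-exponent : ∀ x → 6 · x ≡ 0²
ℤ₆²-exponent (a , b) = from-yes (all? λ a → all? λ b → 6 · (a , b) ≟² 0²) a b

parity : ℤ₆² → Bool × Bool
parity (a , b) = even₆ a , even₆ b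

Even² : Pred ℤ₆² 0ℓ
Even² (a , b) = T (even₆ a) × T (even₆ b)

even²? : Decidable Even²
even²? (a , b) = T? (even₆ a) ×-dec T? (even₆ b)

-- parity identifies ℤ₆² / 2ℤ₆² with ℤ₂², so its fibres are the cosets of 2ℤ₆².
parity-sub : ∀ x y → parity x ≡ parity y → Even² (x -² y)
parity-sub (a , b) (c , d) eq = even₆-sub a c (cong proj₁ eq) , even₆-sub b d (cong proj₂ eq)

sum²-++ : ∀ S S′ → sum² (S ++ S′) ≡ sum² S +² sum² S′
sum²-++ []      S′ = sym (identityˡ (sum² S′))
sum²-++ (s ∷ S) S′ = trans (cong (s +²_) (sum²-++ S S′)) (sym (+²-assoc s (sum² S) (sum² S′)))

sum²-↭ : ∀ {S S′} → S ↭ S′ → sum² S ≡ sum² S′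
sum²-↭ = foldr-commMonoid (setoid ℤ₆²) isCommutativeMonoid ∘ ↭⇒↭ₛ

sum²-translate : ∀ h S → sum² (map (_+² h) S) ≡ sum² S +² (length S · h)
sum²-translate h []      = sym (identityˡ 0²)
sum²-translate h (s ∷ S) =
  trans (cong ((s +² h) +²_) (sum²-translate h S)) (interchange s h (sum² S) (length S · h))

SubsetSum : ℕ → List ℤ₆² → ℤ₆² → Set
SubsetSum k C v = Σ (List ℤ₆²) λ S → S ⊆ C × length S ≡ k × sum² S ≡ v

subsetSum-[] : ∀ C → SubsetSum 0 C 0²
subsetSum-[] C = [] , []⊆-universal C , refl , refl

subsetSum-∈ : ∀ {C x} → x ∈ C → SubsetSum 1 C x
subsetSum-∈ {x = x} x∈C = [ x ] , from∈ x∈C , refl , identityʳ x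

subsetSum-++ : ∀ {k l C D v w} → SubsetSum k C v → SubsetSum l D w → SubsetSum (k + l) (C ++ D) (v +² w)
subsetSum-++ (S , S⊆C , refl , refl) (S′ , S′⊆D , refl , refl) =
  S ++ S′ , ++⁺ S⊆C S′⊆D , length-++ S , sum²-++ S S′

subsetSum-mono : ∀ {k C D v} → C ⊆ D → SubsetSum k C v → SubsetSum k D v
subsetSum-mono C⊆D (S , S⊆C , |S| , ΣS) = S , ⊆-trans S⊆C C⊆D , |S| , ΣS

subsetSum-translate : ∀ {k C v} h → SubsetSum k C v → SubsetSum k (map (_+² h) C) (v +² (k · h))
subsetSum-translate h (S , S⊆C , refl , refl) = map (_+² h) S , map⁺ _ S⊆C , length-map _ S , sum²-translate h S

subsetSum-⊇ : ∀ {k C D v} → Unique C → Unique D → (∀ {x} → x ∈ D → x ∈ C) →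
              SubsetSum k D v → SubsetSum k C v
subsetSum-⊇ {C = C} uC uD D⊆C (S , S⊆D , |S| , ΣS) =
  S′ , filter-⊆ (_∈? S) C , trans (↭-length S′↭S) |S| , trans (sum²-↭ S′↭S) ΣS
  where
    S′ : List ℤ₆²
    S′ = filter (_∈? S) C
    S′↭S : S′ ↭ S
    S′↭S = ↭-from-members (Unique.filter⁺ (_∈? S) uC) (Unique-resp-⊇ S⊆D uD)
             (proj₂ ∘ ∈-filter⁻ (_∈? S) {xs = C})
             (λ x∈S → ∈-filter⁺ (_∈? S) (D⊆C (Any-resp-⊆ S⊆D x∈S)) x∈S)

subsetSum-untranslate : ∀ {C} h → SubsetSum 6 (map (_-² h) C) 0² → SubsetSum 6 C 0²
subsetSum-untranslate {C} h zs = subst₂ (SubsetSum 6) map-back sum-back (subsetSum-translate h zs)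
  where
    map-back : map (_+² h) (map (_-² h) C) ≡ C
    map-back = trans (sym (map-∘ C)) (map-id-local (All.tabulate λ {x} _ → //-rightDividesˡ h x))
    sum-back : 0² +² (6 · h) ≡ 0²
    sum-back = trans (identityˡ _) (ℤ₆²-exponent h)

-- Tables of subset sums

BitTable : Set
BitTable = Vec (Vec Bool 6) 6

_∈ᵗ_ : ℤ₆² → BitTable → Bool
(a , b) ∈ᵗ t = lookup (lookup t a) b

tableOf : (ℤ₆² → Bool) → BitTable
tableOf p = tabulate λ a → tabulate λ b → p (a , b)

∈ᵗ-tableOf : ∀ p v → T (v ∈ᵗ tableOf p) → T (p v)
∈ᵗ-tableOf p (a , b) = subst T
  (trans (cong (λ r → lookup r b) (lookup∘tabulate (λ a → tabulate λ b → p (a , b)) a))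
         (lookup∘tabulate (λ b → p (a , b)) b))

_∪ᵗ_ : BitTable → BitTable → BitTable
_∪ᵗ_ = zipWith (zipWith _∨_)

∈ᵗ-∪ᵗ : ∀ s t v → v ∈ᵗ (s ∪ᵗ t) ≡ v ∈ᵗ s ∨ v ∈ᵗ t
∈ᵗ-∪ᵗ s t (a , b) =
  trans (cong (λ r → lookup r b) (lookup-zipWith (zipWith _∨_) a s t))
        (lookup-zipWith _∨_ b (lookup s a) (lookup t a))

-- Explicit permutations, unlike tabulate, keep table entries shared when the search is evaluated.
rotate : {A : Set} → ℤ₆ → Vec A 6 → Vec A 6
rotate zero                                 r = r
rotate (suc zero)                           (r₀ ∷ r₁ ∷ r₂ ∷ r₃ ∷ r₄ ∷ r₅ ∷ []) = r₅ ∷ r₀ ∷ r₁ ∷ r₂ ∷ r₃ ∷ r₄ ∷ []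
rotate (suc (suc zero))                     (r₀ ∷ r₁ ∷ r₂ ∷ r₃ ∷ r₄ ∷ r₅ ∷ []) = r₄ ∷ r₅ ∷ r₀ ∷ r₁ ∷ r₂ ∷ r₃ ∷ []
rotate (suc (suc (suc zero)))               (r₀ ∷ r₁ ∷ r₂ ∷ r₃ ∷ r₄ ∷ r₅ ∷ []) = r₃ ∷ r₄ ∷ r₅ ∷ r₀ ∷ r₁ ∷ r₂ ∷ []
rotate (suc (suc (suc (suc zero))))         (r₀ ∷ r₁ ∷ r₂ ∷ r₃ ∷ r₄ ∷ r₅ ∷ []) = r₂ ∷ r₃ ∷ r₄ ∷ r₅ ∷ r₀ ∷ r₁ ∷ []
rotate (suc (suc (suc (suc (suc zero)))))   (r₀ ∷ r₁ ∷ r₂ ∷ r₃ ∷ r₄ ∷ r₅ ∷ []) = r₁ ∷ r₂ ∷ r₃ ∷ r₄ ∷ r₅ ∷ r₀ ∷ []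

rotate-tabulate : {A : Set} (p : ℤ₆) (r : Vec A 6) → rotate p r ≡ tabulate λ i → lookup r (i +₆ neg₆ p)
rotate-tabulate zero                               (r₀ ∷ r₁ ∷ r₂ ∷ r₃ ∷ r₄ ∷ r₅ ∷ []) = refl
rotate-tabulate (suc zero)                         (r₀ ∷ r₁ ∷ r₂ ∷ r₃ ∷ r₄ ∷ r₅ ∷ []) = refl
rotate-tabulate (suc (suc zero))                   (r₀ ∷ r₁ ∷ r₂ ∷ r₃ ∷ r₄ ∷ r₅ ∷ []) = refl
rotate-tabulate (suc (suc (suc zero)))             (r₀ ∷ r₁ ∷ r₂ ∷ r₃ ∷ r₄ ∷ r₅ ∷ []) = refl
rotate-tabulate (suc (suc (suc (suc zero))))       (r₀ ∷ r₁ ∷ r₂ ∷ r₃ ∷ r₄ ∷ r₅ ∷ []) = refl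
rotate-tabulate (suc (suc (suc (suc (suc zero))))) (r₀ ∷ r₁ ∷ r₂ ∷ r₃ ∷ r₄ ∷ r₅ ∷ []) = refl

lookup-rotate : {A : Set} (p : ℤ₆) (r : Vec A 6) (i : ℤ₆) → lookup (rotate p r) i ≡ lookup r (i +₆ neg₆ p)
lookup-rotate p r i =
  trans (cong (λ r′ → lookup r′ i) (rotate-tabulate p r)) (lookup∘tabulate (λ j → lookup r (j +₆ neg₆ p)) i)

shift : ℤ₆² → BitTable → BitTable
shift (p , q) t = rotate p (mapᵛ (rotate q) t)

∈ᵗ-shift : ∀ x t v → v ∈ᵗ shift x t ≡ (v -² x) ∈ᵗ t
∈ᵗ-shift (p , q) t (a , b) = begin
  lookup (lookup (rotate p (mapᵛ (rotate q) t)) a) b      ≡⟨ cong (λ r → lookup r b) (lookup-rotate p _ a) ⟩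
  lookup (lookup (mapᵛ (rotate q) t) (a +₆ neg₆ p)) b     ≡⟨ cong (λ r → lookup r b) (lookup-map (a +₆ neg₆ p) (rotate q) t) ⟩
  lookup (rotate q (lookup t (a +₆ neg₆ p))) b           ≡⟨ lookup-rotate q _ b ⟩
  lookup (lookup t (a +₆ neg₆ p)) (b +₆ neg₆ q)          ∎
  where open ≡-Reasoning

Sound : List ℤ₆² → ℕ → BitTable → Set
Sound C k t = ∀ v → T (v ∈ᵗ t) → SubsetSum k C v

Sound-∪ᵗ : ∀ {C k s t} → Sound C k s → Sound C k t → Sound C k (s ∪ᵗ t)
Sound-∪ᵗ {s = s} {t} s-sound t-sound v v∈ =
  [ s-sound v , t-sound v ]′ (Equivalence.to T-∨ (subst T (∈ᵗ-∪ᵗ s t v) v∈))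

Sound-shift : ∀ {C k t} x → Sound C k t → Sound (C ++ [ x ]) (suc k) (shift x t)
Sound-shift {C} {k} {t} x t-sound v v∈ =
  subst₂ (λ l w → SubsetSum l (C ++ [ x ]) w) (+-comm k 1) (//-rightDividesˡ x v)
         (subsetSum-++ (t-sound (v -² x) (subst T (∈ᵗ-shift x t v) v∈)) (subsetSum-∈ (here refl)))

-- A stack of length n lists the tables of n-, (n-1)-, …, 1-element subset sums; below them
-- lies the table {0²} of 0-element sums.
lowest : ∀ {n} → Vec BitTable n → BitTable
lowest []      = tableOf λ v → isYes (v ≟² 0²)
lowest (t ∷ _) = t

insert : ∀ {n} → ℤ₆² → Vec BitTable n → Vec BitTable n
insert x []       = []
insert x (t ∷ ts) = (t ∪ᵗ shift x (lowest ts)) ∷ insert x ts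

AllSound : ∀ {n} → List ℤ₆² → Vec BitTable n → Set
AllSound C []                = ⊤
AllSound {suc n} C (t ∷ ts) = Sound C (suc n) t × AllSound C ts

lowest-sound : ∀ {n C} (ts : Vec BitTable n) → AllSound C ts → Sound C n (lowest ts)
lowest-sound {C = C} [] _ v v∈ =
  subst (SubsetSum 0 C) (sym (toWitness {a? = v ≟² 0²} (∈ᵗ-tableOf (λ w → isYes (w ≟² 0²)) v v∈))) (subsetSum-[] C)
lowest-sound (t ∷ ts) (t-sound , _) = t-sound

insert-sound : ∀ {n C} x (ts : Vec BitTable n) → AllSound C ts → AllSound (C ++ [ x ]) (insert x ts)
insert-sound x []       _                   = tt
insert-sound x (t ∷ ts) (t-sound , ts-sound) =
  Sound-∪ᵗ {s = t} {t = shift x (lowest ts)} (λ v v∈ → subsetSum-mono (++⁺ʳ [ x ] ⊆-refl) (t-sound v v∈))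
                                             (Sound-shift {t = lowest ts} x (lowest-sound ts ts-sound)) ,
  insert-sound x ts ts-sound

emptyTables : ∀ n → Vec BitTable n
emptyTables n = replicate n (tableOf λ _ → false)

emptyTables-sound : ∀ n → AllSound [] (emptyTables n)
emptyTables-sound zero    = tt
emptyTables-sound (suc n) = (λ v v∈ → contradiction (∈ᵗ-tableOf _ v v∈) id) , emptyTables-sound n

-- Verified exhaustive search

evens : List ℤ₆² → ℕ
evens = count even²?

Completes : ∀ {n} → Vec BitTable n → Pred ℤ₆² 0ℓ
Completes ts y = T (neg² y ∈ᵗ lowest ts)

completes? : ∀ {n} (ts : Vec BitTable n) → Decidable (Completes ts)
completes? ts y = T? (neg² y ∈ᵗ lowest ts)

safeIn : ∀ {n} → Vec BitTable n → List ℤ₆² → List ℤ₆²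
safeIn ts = filter (∁? (completes? ts))

zeroSum-or-safe : ∀ {n C Y V} (ts : Vec BitTable n) → AllSound C ts → Y ⊆ V →
                  SubsetSum (suc n) (C ++ Y) 0² ⊎ Y ⊆ safeIn ts V
zeroSum-or-safe {n} {C} {Y} {V} ts sound Y⊆V with any? (completes? ts) Y
... | yes completing =
  let y , y∈Y , -y∈ = find completing in
  inj₁ (subst₂ (λ k w → SubsetSum k (C ++ Y) w) (+-comm n 1) (inverseˡ y)
               (subsetSum-++ (lowest-sound ts sound (neg² y) -y∈) (subsetSum-∈ y∈Y)))
... | no ¬completing =
  inj₂ (subst (_⊆ safeIn ts V) (filter-all (∁? (completes? ts)) (¬Any⇒All¬ Y ¬completing))
              (filter⁺ (∁? (completes? ts)) (∁? (completes? ts)) (λ { refl → id }) Y⊆V))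

if-true : ∀ {b c} → T b → (if b then c else true) ≡ true → c ≡ true
if-true {true} _ c≡true = c≡true

∧-true : ∀ {b c} → b ∧ c ≡ true → b ≡ true × c ≡ true
∧-true {true} {true} _ = refl , refl

module Search (N E : ℕ) where

  viable : List ℤ₆² → List ℤ₆² → Bool
  viable C V = (N ≤ᵇ length C + length V) ∧ (E ≤ᵇ evens C + evens V)

  -- C is the chosen part, ts its sum tables and V the remaining candidates; f is fuel.
  -- A branch is closed (true) once it cannot reach N elements with E even ones.
  search : ∀ {n} → ℕ → List ℤ₆² → Vec BitTable n → List ℤ₆² → Bool
  branch : ∀ {n} → ℕ → List ℤ₆² → Vec BitTable n → List ℤ₆² → Bool
  search zero    C ts V = false
  search (suc f) C ts V = if viable C V then branch f C ts V else true
  branch f C ts []      = false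
  branch f C ts (u ∷ V) = search f (C ++ [ u ]) (insert u ts) (safeIn (insert u ts) V) ∧ search f C ts V

  viable-T : ∀ C {Y V} → Y ⊆ V → length C + length Y ≡ N → E ≤ evens C + evens Y → T (viable C V)
  viable-T C Y⊆V |CY| eCY = Equivalence.from T-∧
    ( ≤⇒≤ᵇ (subst (_≤ _) |CY| (+-monoʳ-≤ (length C) (length-mono-≤ Y⊆V)))
    , ≤⇒≤ᵇ (≤-trans eCY (+-monoʳ-≤ (evens C) (length-mono-≤ (filter⁺ even²? even²? (λ { refl → id }) Y⊆V)))))

  search-sound : ∀ {n} f C (ts : Vec BitTable n) V → AllSound C ts → search f C ts V ≡ true →
                 ∀ {Y} → Y ⊆ V → length C + length Y ≡ N → E ≤ evens C + evens Y →
                 SubsetSum (suc n) (C ++ Y) 0²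
  branch-sound : ∀ {n} f C (ts : Vec BitTable n) V → AllSound C ts → branch f C ts V ≡ true →
                 ∀ {Y} → Y ⊆ V → length C + length Y ≡ N → E ≤ evens C + evens Y →
                 SubsetSum (suc n) (C ++ Y) 0²
  search-sound zero    C ts V sound () Y⊆V |CY| eCY
  search-sound (suc f) C ts V sound found Y⊆V |CY| eCY =
    branch-sound f C ts V sound (if-true (viable-T C Y⊆V |CY| eCY) found) Y⊆V |CY| eCY
  branch-sound f C ts [] sound () Y⊆V |CY| eCY
  branch-sound f C ts (u ∷ V) sound found (u ∷ʳ Y⊆V) |CY| eCY =
    search-sound f C ts V sound (proj₂ (∧-true found)) Y⊆V |CY| eCY
  branch-sound {n} f C ts (u ∷ V) sound found {u ∷ Y} (refl ∷ Y⊆V) |CY| eCY =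
    subst (λ L → SubsetSum (suc n) L 0²) (++-assoc C [ u ] Y)
          (included (zeroSum-or-safe (insert u ts) sound′ Y⊆V))
    where
      sound′ : AllSound (C ++ [ u ]) (insert u ts)
      sound′ = insert-sound u ts sound
      included : SubsetSum (suc n) ((C ++ [ u ]) ++ Y) 0² ⊎ Y ⊆ safeIn (insert u ts) V →
                 SubsetSum (suc n) ((C ++ [ u ]) ++ Y) 0²
      included (inj₁ zeroSum) = zeroSum
      included (inj₂ Y⊆safe)  =
        search-sound f (C ++ [ u ]) (insert u ts) _ sound′ (proj₁ (∧-true found)) Y⊆safe
          (trans (additive-moveˡ length (λ xs _ → length-++ xs) C u Y) |CY|)
          (subst (E ≤_) (sym (additive-moveˡ evens (count-++ even²?) C u Y)) eCY)

-- Reduction to the search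

elements : List ℤ₆²
elements = cartesianProduct (allFin 6) (allFin 6)

searchOrder : List ℤ₆²
searchOrder = filter (λ v → ¬? (v ≟² 0²) ×-dec even²? v) elements ++ filter (∁? even²?) elements

searchOrder-complete : ∀ v → v ∈ 0² ∷ searchOrder
searchOrder-complete (a , b) = from-yes (all? λ a → all? λ b → (a , b) ∈? 0² ∷ searchOrder) a b

searchOrder-unique : Unique (0² ∷ searchOrder)
searchOrder-unique = from-yes (unique? (0² ∷ searchOrder))

parities : List (Bool × Bool)
parities = (true , true) ∷ (true , false) ∷ (false , true) ∷ (false , false) ∷ []

parities-complete : ∀ p → p ∈ parities
parities-complete (true  , true)  = here refl
parities-complete (true  , false) = there (here refl)
parities-complete (false , true)  = there (there (here refl))
parities-complete (false , false) = there (there (there (here refl)))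

coset? : (c : Bool × Bool) → Decidable (λ x → parity x ≡ c)
coset? = fibre? (≡-dec _≟ᵇ_ _≟ᵇ_) parity

crowded-coset : ∀ X → length X ≡ 13 → ∃ λ h → h ∈ X × 4 ≤ count (coset? (parity h)) X
crowded-coset X |X| with any? (λ c → 4 ≤? count (coset? c) X) parities
... | yes crowded =
  let c , _ , 4≤ = find crowded
      h , h∈coset = member-of-nonempty (≤-trans (s≤s z≤n) 4≤)
      h∈X , ph≡c = ∈-filter⁻ (coset? c) {xs = X} h∈coset
  in h , h∈X , subst (λ c → 4 ≤ count (coset? c) X) (sym ph≡c) 4≤
... | no ¬crowded = contradiction (subst (_≤ 12) |X| |X|≤12) (n≮n 12)
  where
    |X|≤12 : length X ≤ length parities * 3
    |X|≤12 = pigeonhole (≡-dec _≟ᵇ_ _≟ᵇ_) parity parities X (All.tabulate λ {x} _ → parities-complete (parity x))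
              (All.map (≤-pred ∘ ≰⇒>) (¬Any⇒All¬ parities ¬crowded))

translate-unique : ∀ h {X} → Unique X → Unique (map (_-² h) X)
translate-unique h = Unique.map⁺ λ {x} {y} eq →
  trans (sym (//-rightDividesˡ h x)) (trans (cong (_+² h) eq) (//-rightDividesˡ h y))

0∈translate : ∀ {h X} → h ∈ X → 0² ∈ map (_-² h) X
0∈translate {h} {X} h∈X = subst (_∈ map (_-² h) X) (inverseʳ h) (∈-map⁺ (_-² h) h∈X)

evens-translate : ∀ h X → count (coset? (parity h)) X ≤ evens (map (_-² h) X)
evens-translate h X = ≤-trans (count-mono (coset? (parity h)) (even²? ∘ (_-² h)) (λ {x} → parity-sub x h) X)
                              (≤-reflexive (sym (count-map even²? (_-² h) X)))

initialTables : Vec BitTable 5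
initialTables = insert 0² (emptyTables 5)

-- Checked by refl, which evaluates the search much faster than checking tt against T (…).
-- Search.search 13 4 is named directly rather than through an opened copy of the module, so that
-- this type and that of search-sound agree syntactically; otherwise Agda compares them by running
-- the search again.
search-succeeds : Search.search 13 4 40 [ 0² ] initialTables searchOrder ≡ true
search-succeeds = refl

zeroSum-containing-0 : ∀ {X} → Unique X → length X ≡ 13 → 0² ∈ X → 4 ≤ evens X → SubsetSum 6 X 0²
zeroSum-containing-0 {X} uX |X| 0∈X 4≤evens = subsetSum-⊇ uX uZ Z⊆X sumZ
  where
    Y : List ℤ₆²
    Y = filter (_∈? X) searchOrder
    Z≡ : filter (_∈? X) (0² ∷ searchOrder) ≡ 0² ∷ Y
    Z≡ = filter-accept (_∈? X) 0∈X
    uZ : Unique (0² ∷ Y)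
    uZ = subst Unique Z≡ (Unique.filter⁺ (_∈? X) searchOrder-unique)
    Z⊆X : ∀ {x} → x ∈ 0² ∷ Y → x ∈ X
    Z⊆X x∈Z = proj₂ (∈-filter⁻ (_∈? X) {xs = 0² ∷ searchOrder} (subst (_ ∈_) (sym Z≡) x∈Z))
    Z↭X : 0² ∷ Y ↭ X
    Z↭X = ↭-from-members uZ uX Z⊆X (λ x∈X → subst (_ ∈_) Z≡ (∈-filter⁺ (_∈? X) (searchOrder-complete _) x∈X))
    lenZ : length [ 0² ] + length Y ≡ 13
    lenZ = trans (↭-length Z↭X) |X|
    evZ : 4 ≤ evens [ 0² ] + evens Y
    evZ = subst (4 ≤_) (sym (↭-length (filter-↭ even²? Z↭X))) 4≤evens
    sumZ : SubsetSum 6 (0² ∷ Y) 0²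
    sumZ = Search.search-sound 13 4 40 [ 0² ] initialTables searchOrder
             (insert-sound 0² (emptyTables 5) (emptyTables-sound 5))
             search-succeeds (filter-⊆ (_∈? X) searchOrder) lenZ evZ

theorem4p1 : (X : List ℤ₆²) → Unique X → length X ≡ 13 →
    Σ (List ℤ₆²) (λ S → S ⊆ X × length S ≡ 6 × sum² S ≡ 0²)
theorem4p1 X uX |X| =
  let h , h∈X , crowded = crowded-coset X |X| in
  subsetSum-untranslate h
    (zeroSum-containing-0 (translate-unique h uX)
                          (trans (length-map (_-² h) X) |X|)
                          (0∈translate h∈X)
                          (≤-trans crowded (evens-translate h X)))
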